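{- Let $d\ge 5$, $u\in V(Q_d)$, and let $M$ be a matching of $Q_d$. Assume property (P$_d$) below holds. Then there are at most two neighbors $w$ of $u$ for which there is no Hamilton path of $Q_d$ between $u$ and $w$ containing all edges of $M$. Property (P$_d$): for every matching $M'$ of $Q_d$ and every two vertices $a,b\in V(Q_d)$ of opposite parity, there is a Hamilton path of $Q_d$ between $a$ and $b$ containing all edges of $M'$ if and only if none of the conditions C1, C2, C3 (for $M'$, $a$, $b$) holds.
   Context: $Q_d$ has vertex set $\{0,1\}^d$, two vertices adjacent iff they differ in exactly one coordinate; the parity of a vertex is the parity of its number of ones. For a vertex $x$ and direction $i$, $x^i$ is $x$ with coordinate $i$ flipped. A half-layer in direction $i$ is a set $\{x x^i : x_i = 0,\ x \text{ has parity } p\}$ for a fixed parity $p$. A $u$-avoiding almost half-layer in direction $i$ is $H\setminus\{uu^i\}$ where $H$ is the half-layer in direction $i$ containing $uu^i$. A vertex is covered by a set of edges if it is an endpoint of one of them. For a matching $M'$ and vertices $a,b$ of opposite parity: C1: $M'$ contains a half-layer $H$ covering both $a$ and $b$. C2: there are directions $i\ne j$ with $b=a^i$, $M'$ contains the $a$-avoiding almost half-layer in direction $i$, and $aa^j, bb^j\in M'$. C3: $ab\in M'$. -}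

module Defs where

open import Data.Nat using (ℕ)
open import Data.Bool using (Bool; true; false; not; _xor_)
open import Data.Fin using (Fin)
open import Data.Vec using (Vec; lookup; updateAt; foldr)
open import Data.Vec.Properties using (lookup∘updateAt)
open import Data.List as L using (List; head; last; zip; drop)
open import Data.List.Relation.Unary.All using (All)
open import Data.List.Relation.Unary.Any using (Any)
open import Data.List.Relation.Unary.Unique.Propositional using (Unique)
open import Data.List.Membership.Propositional using (_∈_)
open import Data.Maybe using (just)
open import Data.Product using (Σ; ∃; ∃-syntax; _×_; _,_)
open import Data.Sum using (_⊎_)
open import Relation.Nullary using (¬_)
open import Relation.Binary.PropositionalEquality using (_≡_; _≢_; refl; trans; cong)

-- Vertices of Q_d: 0/1-vectors of length d (false = 0, true = 1).
Vertex : ℕ → Set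
Vertex d = Vec Bool d

flip : ∀ {d} → Vertex d → Fin d → Vertex d
flip x i = updateAt x i not

parity : ∀ {d} → Vertex d → Bool
parity = foldr _ _xor_ false

-- An edge of Q_d, stored canonically as (low endpoint x with x_i = 0, direction i);
-- it is the edge x x^i.
record Edge (d : ℕ) : Set where
  constructor edge
  field
    low   : Vertex d
    dir   : Fin d
    isLow : lookup low dir ≡ false
open Edge public

mkEdge : ∀ {d} → Vertex d → Fin d → Edge d
mkEdge x i with lookup x i in eq
... | false = edge x i eq
... | true  = edge (flip x i) i (trans (lookup∘updateAt i x) (cong not eq))

Endpoint : ∀ {d} → Vertex d → Edge d → Set
Endpoint v e = (v ≡ low e) ⊎ (v ≡ flip (low e) (dir e))

EdgeSet : ℕ → Set₁
EdgeSet d = Edge d → Set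

IsMatching : ∀ {d} → EdgeSet d → Set
IsMatching {d} M = ∀ (e f : Edge d) → M e → M f →
  ∀ (v : Vertex d) → Endpoint v e → Endpoint v f → e ≡ f

Adjacent : ∀ {d} → Vertex d → Vertex d → Set
Adjacent x y = ∃[ i ] (y ≡ flip x i)

consecutive : ∀ {A : Set} → List A → List (A × A)
consecutive xs = zip xs (drop 1 xs)

Traverses : ∀ {d} → Vertex d × Vertex d → Edge d → Set
Traverses (x , y) e =
  (x ≡ low e × y ≡ flip (low e) (dir e)) ⊎ (y ≡ low e × x ≡ flip (low e) (dir e))

record IsHamPath {d : ℕ} (P : List (Vertex d)) (a b : Vertex d) : Set where
  field
    distinct : Unique P
    spanning : ∀ (v : Vertex d) → v ∈ P
    steps    : All (λ p → Adjacent (Data.Product.proj₁ p) (Data.Product.proj₂ p)) (consecutive P)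
    starts   : head P ≡ just a
    ends     : last P ≡ just b

PathContains : ∀ {d} → List (Vertex d) → Edge d → Set
PathContains P e = Any (λ p → Traverses p e) (consecutive P)

HamPathThrough : ∀ {d} → EdgeSet d → Vertex d → Vertex d → Set
HamPathThrough {d} M a b =
  ∃[ P ] (IsHamPath P a b × (∀ (e : Edge d) → M e → PathContains P e))

InHalfLayer : ∀ {d} → Fin d → Bool → Edge d → Set
InHalfLayer i p e = (dir e ≡ i) × (parity (low e) ≡ p)

C1 : ∀ {d} → EdgeSet d → Vertex d → Vertex d → Set
C1 {d} M a b = ∃[ i ] ∃[ p ]
  ( (∀ (e : Edge d) → InHalfLayer i p e → M e)
  × (∃[ e ] (InHalfLayer i p e × Endpoint a e))
  × (∃[ e ] (InHalfLayer i p e × Endpoint b e)) )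

C2 : ∀ {d} → EdgeSet d → Vertex d → Vertex d → Set
C2 {d} M a b = ∃[ i ] ∃[ j ]
  ( (i ≢ j)
  × (b ≡ flip a i)
  × (∀ (e : Edge d) → InHalfLayer i (parity (low (mkEdge a i))) e → e ≢ mkEdge a i → M e)
  × M (mkEdge a j)
  × M (mkEdge b j) )

C3 : ∀ {d} → EdgeSet d → Vertex d → Vertex d → Set
C3 M a b = ∃[ e ] (M e × Endpoint a e × Endpoint b e)

PropertyP : ℕ → Set₁
PropertyP d = ∀ (M' : EdgeSet d) → IsMatching M' → ∀ (a b : Vertex d) →
  parity a ≢ parity b →
  (HamPathThrough M' a b → ¬ (C1 M' a b ⊎ C2 M' a b ⊎ C3 M' a b))
  × (¬ (C1 M' a b ⊎ C2 M' a b ⊎ C3 M' a b) → HamPathThrough M' a b)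

{-# OPTIONS --safe #-}
-- A neighbour u^i has no Hamilton path exactly when C1, C2 or C3 holds for M, u, u^i. For k ≠ i
-- the half-layers in direction k covering u and u^i have different parities, so C1 and C3 both
-- force the M-edge at u to have direction i, which happens for at most one i. C2 forces M to contain
-- a half-layer in direction i minus one edge, and two of these, in directions i ≠ j, cannot coexist:
-- take w whose neighbours w^a, w^b, w^c (a, b, c ∉ {i, j}, so d ≥ 5) lie in both half-layers; their
-- i-edges are pairwise distinct and so are their j-edges, so one of the three neighbours keeps both
-- of its edges, and these meet in M.
module Submission where

open import Defs
open import Data.Nat using (ℕ; suc; _+_; _≤_; s≤s)
open import Data.Fin using (Fin; zero; suc; punchIn; punchOut)
open import Data.Fin.Properties using (_≟_; punchIn-injective; punchInᵢ≢i; punchIn-punchOut)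
open import Data.Bool using (Bool; true; false; not; _xor_)
open import Data.Bool.Properties using (not-involutive; not-¬; ¬-not; not-distribˡ-xor; not-distribʳ-xor; xor-identityʳ)
  renaming (_≟_ to _≟ᵇ_)
open import Data.Vec using (_∷_; lookup; replicate)
open import Data.Vec.Properties using (lookup∘updateAt; lookup∘updateAt′; updateAt-updateAt-local; updateAt-id)
open import Data.Product using (_×_; _,_; proj₁; proj₂; ∃-syntax)
open import Data.Sum using (_⊎_; inj₁; inj₂)
open import Data.Empty using (⊥)
open import Function using (_∘_)
open import Relation.Nullary using (¬_; yes; no; contradiction)
open import Relation.Binary.PropositionalEquality

lookup-flip : ∀ {d} (x : Vertex d) i → lookup (flip x i) i ≡ not (lookup x i)
lookup-flip x i = lookup∘updateAt i x

lookup-flip-other : ∀ {d} (x : Vertex d) {i j} → j ≢ i → lookup (flip x i) j ≡ lookup x j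
lookup-flip-other x {i} {j} j≢i = lookup∘updateAt′ j i j≢i x

flip-involutive : ∀ {d} (x : Vertex d) i → flip (flip x i) i ≡ x
flip-involutive x i =
  trans (updateAt-updateAt-local i x (not-involutive (lookup x i))) (updateAt-id i x)

flip-injective : ∀ {d} (x : Vertex d) {i j} → flip x i ≡ flip x j → i ≡ j
flip-injective x {i} {j} eq with i ≟ j
... | yes i≡j = i≡j
... | no i≢j = contradiction (sym (begin
  not (lookup x i)     ≡⟨ sym (lookup-flip x i) ⟩
  lookup (flip x i) i  ≡⟨ cong (λ y → lookup y i) eq ⟩
  lookup (flip x j) i  ≡⟨ lookup-flip-other x i≢j ⟩
  lookup x i           ∎)) (not-¬ refl)
  where open ≡-Reasoning

parity-flip : ∀ {d} (x : Vertex d) i → parity (flip x i) ≡ not (parity x)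
parity-flip (b ∷ x) zero    = sym (not-distribˡ-xor b (parity x))
parity-flip (b ∷ x) (suc i) =
  trans (cong (b xor_) (parity-flip x i)) (sym (not-distribʳ-xor b (parity x)))

-- Every vertex x is covered by exactly one half-layer in direction i, the one of this parity.
halfLayerParity : ∀ {d} → Vertex d → Fin d → Bool
halfLayerParity x i = parity x xor lookup x i

not-xor-not : ∀ a b → not a xor not b ≡ a xor b
not-xor-not false b = not-involutive b
not-xor-not true  b = refl

halfLayerParity-flip : ∀ {d} (x : Vertex d) i → halfLayerParity (flip x i) i ≡ halfLayerParity x i
halfLayerParity-flip x i =
  trans (cong₂ _xor_ (parity-flip x i) (lookup-flip x i)) (not-xor-not (parity x) (lookup x i))

halfLayerParity-flip-other : ∀ {d} (x : Vertex d) {i j} → j ≢ i →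
  halfLayerParity (flip x i) j ≡ not (halfLayerParity x j)
halfLayerParity-flip-other x {i} {j} j≢i =
  trans (cong₂ _xor_ (parity-flip x i) (lookup-flip-other x j≢i))
        (sym (not-distribˡ-xor (parity x) (lookup x j)))

halfLayerParity-flip⇒≡ : ∀ {d} (x : Vertex d) {i j} →
  halfLayerParity x j ≡ halfLayerParity (flip x i) j → j ≡ i
halfLayerParity-flip⇒≡ x {i} {j} eq with j ≟ i
... | yes j≡i = j≡i
... | no j≢i = contradiction (trans eq (halfLayerParity-flip-other x j≢i)) (not-¬ refl)

halfLayerParity-endpoint : ∀ {d} {x : Vertex d} (e : Edge d) → Endpoint x e →
  halfLayerParity x (dir e) ≡ parity (low e)
halfLayerParity-endpoint e (inj₁ refl) = halfLayerParity-low
  where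
  halfLayerParity-low : halfLayerParity (low e) (dir e) ≡ parity (low e)
  halfLayerParity-low = trans (cong (parity (low e) xor_) (isLow e)) (xor-identityʳ _)
halfLayerParity-endpoint e (inj₂ refl) =
  trans (halfLayerParity-flip (low e) (dir e)) (halfLayerParity-endpoint e (inj₁ refl))

halfLayerParity-cover : ∀ {d} {x : Vertex d} {i p} (e : Edge d) → InHalfLayer i p e → Endpoint x e →
  halfLayerParity x i ≡ p
halfLayerParity-cover e (refl , refl) x∈e = halfLayerParity-endpoint e x∈e

inHalfLayer : ∀ {d} {x : Vertex d} {i p} (e : Edge d) → Endpoint x e → dir e ≡ i →
  halfLayerParity x i ≡ p → InHalfLayer i p e
inHalfLayer e x∈e refl hx = refl , trans (sym (halfLayerParity-endpoint e x∈e)) hx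

endpoints-agree-off-dir : ∀ {d} {x y : Vertex d} (e : Edge d) → Endpoint x e → Endpoint y e →
  ∀ {k} → k ≢ dir e → lookup x k ≡ lookup y k
endpoints-agree-off-dir e (inj₁ refl) (inj₁ refl) k≢dir = refl
endpoints-agree-off-dir e (inj₁ refl) (inj₂ refl) k≢dir = sym (lookup-flip-other (low e) k≢dir)
endpoints-agree-off-dir e (inj₂ refl) (inj₁ refl) k≢dir = lookup-flip-other (low e) k≢dir
endpoints-agree-off-dir e (inj₂ refl) (inj₂ refl) k≢dir = refl

edgeAt : ∀ {d} (x : Vertex d) i → ∃[ e ] (Endpoint x e × dir e ≡ i)
edgeAt x i with lookup x i in eq
... | false = edge x i eq , inj₁ refl , refl
... | true  = edge (flip x i) i (trans (lookup-flip x i) (cong not eq))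
            , inj₂ (sym (flip-involutive x i)) , refl

matching-dir-unique : ∀ {d} {M : EdgeSet d} {x e f} → IsMatching M → M e → M f →
  Endpoint x e → Endpoint x f → dir e ≡ dir f
matching-dir-unique {e = e} {f} isMatching Me Mf x∈e x∈f = cong dir (isMatching e f Me Mf _ x∈e x∈f)

halfLayerParity-adjust : ∀ {d} (x : Vertex d) {i j} → j ≢ i → ∀ q →
  ∃[ y ] (halfLayerParity y j ≡ q × halfLayerParity y i ≡ halfLayerParity x i)
halfLayerParity-adjust x {i} {j} j≢i q with halfLayerParity x j ≟ᵇ q
... | yes hx≡q = x , hx≡q , refl
... | no  hx≢q = flip x i
               , trans (halfLayerParity-flip-other x j≢i) (sym (¬-not (hx≢q ∘ sym)))
               , halfLayerParity-flip x i

halfLayers-intersect : ∀ {d} {i j : Fin d} → i ≢ j → ∀ p q →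
  ∃[ w ] (halfLayerParity w i ≡ p × halfLayerParity w j ≡ q)
halfLayers-intersect {d} i≢j p q with halfLayerParity-adjust (replicate d false) (≢-sym i≢j) q
... | y , hyj , _ with halfLayerParity-adjust y i≢j p
...   | w , hwi , hwj = w , hwi , trans hwj hyj

neighbour-edges-distinct : ∀ {d} (w : Vertex d) {x y} (e f : Edge d) → x ≢ y → y ≢ dir f →
  Endpoint (flip w x) e → Endpoint (flip w y) f → e ≢ f
neighbour-edges-distinct w {x} {y} e .e x≢y y≢dir wˣ∈e wʸ∈e refl =
  contradiction (begin
    lookup w y             ≡⟨ sym (lookup-flip-other w (≢-sym x≢y)) ⟩
    lookup (flip w x) y    ≡⟨ endpoints-agree-off-dir e wˣ∈e wʸ∈e y≢dir ⟩
    lookup (flip w y) y    ≡⟨ lookup-flip w y ⟩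
    not (lookup w y)       ∎) (not-¬ refl)
  where open ≡-Reasoning

module _ {n} {i j : Fin (suc (suc n))} (i≢j : i ≢ j) where

  avoiding : Fin n → Fin (suc (suc n))
  avoiding x = punchIn i (punchIn (punchOut i≢j) x)

  avoiding-injective : ∀ {x y} → avoiding x ≡ avoiding y → x ≡ y
  avoiding-injective eq = punchIn-injective _ _ _ (punchIn-injective i _ _ eq)

  avoiding≢i : ∀ x → avoiding x ≢ i
  avoiding≢i x = punchInᵢ≢i i _

  avoiding≢j : ∀ x → avoiding x ≢ j
  avoiding≢j x eq = punchInᵢ≢i (punchOut i≢j) x
    (punchIn-injective i _ _ (trans eq (sym (punchIn-punchOut i≢j))))

pigeonhole₃ : ∀ {A : Set} {P Q : A → Set} →
  (∀ {x y} → x ≢ y → P x → P y → ⊥) → (∀ {x y} → x ≢ y → Q x → Q y → ⊥) →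
  ∀ {x y z} → x ≢ y → x ≢ z → y ≢ z → P x ⊎ Q x → P y ⊎ Q y → P z ⊎ Q z → ⊥
pigeonhole₃ P! Q! x≢y x≢z y≢z (inj₁ Px) (inj₁ Py) _         = P! x≢y Px Py
pigeonhole₃ P! Q! x≢y x≢z y≢z (inj₁ Px) (inj₂ Qy) (inj₁ Pz) = P! x≢z Px Pz
pigeonhole₃ P! Q! x≢y x≢z y≢z (inj₁ Px) (inj₂ Qy) (inj₂ Qz) = Q! y≢z Qy Qz
pigeonhole₃ P! Q! x≢y x≢z y≢z (inj₂ Qx) (inj₁ Py) (inj₁ Pz) = P! y≢z Py Pz
pigeonhole₃ P! Q! x≢y x≢z y≢z (inj₂ Qx) (inj₁ Py) (inj₂ Qz) = Q! x≢z Qx Qz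
pigeonhole₃ P! Q! x≢y x≢z y≢z (inj₂ Qx) (inj₂ Qy) _         = Q! x≢y Qx Qy

MatchedInDirection : ∀ {d} → EdgeSet d → Vertex d → Fin d → Set
MatchedInDirection M u i = ∃[ e ] (M e × Endpoint u e × dir e ≡ i)

ContainsAlmostHalfLayer : ∀ {d} → EdgeSet d → Fin d → Set
ContainsAlmostHalfLayer {d} M i = ∃[ p ] ∃[ E ] (∀ (e : Edge d) → InHalfLayer i p e → e ≢ E → M e)

Obstructed : ∀ {d} → EdgeSet d → Vertex d → Vertex d → Set
Obstructed M a b = C1 M a b ⊎ C2 M a b ⊎ C3 M a b

matchedInDirection-unique : ∀ {d} {M : EdgeSet d} {u i j} → IsMatching M →
  MatchedInDirection M u i → MatchedInDirection M u j → i ≡ j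
matchedInDirection-unique isMatching (e , Me , u∈e , refl) (f , Mf , u∈f , refl) =
  matching-dir-unique {e = e} {f} isMatching Me Mf u∈e u∈f

C1⇒matchedInDirection : ∀ {d} {M : EdgeSet d} {u i} → C1 M u (flip u i) → MatchedInDirection M u i
C1⇒matchedInDirection {u = u} {i} (j , p , H⊆M , (e , e∈H , u∈e) , (f , f∈H , u′∈f)) =
  e , H⊆M e e∈H , u∈e , trans (proj₁ e∈H) j≡i
  where
  j≡i : j ≡ i
  j≡i = halfLayerParity-flip⇒≡ u
          (trans (halfLayerParity-cover e e∈H u∈e) (sym (halfLayerParity-cover f f∈H u′∈f)))

C3⇒matchedInDirection : ∀ {d} {M : EdgeSet d} {u i} → C3 M u (flip u i) → MatchedInDirection M u i
C3⇒matchedInDirection {u = u} (e , Me , u∈e , u′∈e) =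
  e , Me , u∈e , halfLayerParity-flip⇒≡ u
    (trans (halfLayerParity-endpoint e u∈e) (sym (halfLayerParity-endpoint e u′∈e)))

C2⇒containsAlmostHalfLayer : ∀ {d} {M : EdgeSet d} {u i} → C2 M u (flip u i) → ContainsAlmostHalfLayer M i
C2⇒containsAlmostHalfLayer {u = u} (j , _ , _ , u′≡u^j , H⊆M , _) with flip-injective u u′≡u^j
... | refl = _ , _ , H⊆M

obstructed-neighbour : ∀ {d} {M : EdgeSet d} {u i} → Obstructed M u (flip u i) →
  MatchedInDirection M u i ⊎ ContainsAlmostHalfLayer M i
obstructed-neighbour (inj₁ c1)        = inj₁ (C1⇒matchedInDirection c1)
obstructed-neighbour (inj₂ (inj₁ c2)) = inj₂ (C2⇒containsAlmostHalfLayer c2)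
obstructed-neighbour (inj₂ (inj₂ c3)) = inj₁ (C3⇒matchedInDirection c3)

almostHalfLayers-conflict : ∀ {m} {M : EdgeSet (5 + m)} → IsMatching M → ∀ {i j} → i ≢ j →
  ContainsAlmostHalfLayer M i → ContainsAlmostHalfLayer M j → ⊥
almostHalfLayers-conflict {m} {M} isMatching {i} {j} i≢j (p , E , Hᵢ⊆M) (q , F , Hⱼ⊆M) =
  blocked zero λ b₀ → blocked (suc zero) λ b₁ → blocked (suc (suc zero)) λ b₂ →
  pigeonhole₃ (removed-once (avoiding≢i i≢j _)) (removed-once (avoiding≢j i≢j _))
              (λ ()) (λ ()) (λ ()) b₀ b₁ b₂
  where
  -- w lies outside both half-layers, so its neighbours in directions other than i, j lie in both.
  w : Vertex (5 + m)
  w = proj₁ (halfLayers-intersect i≢j (not p) (not q))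

  w-parities : halfLayerParity w i ≡ not p × halfLayerParity w j ≡ not q
  w-parities = proj₂ (halfLayers-intersect i≢j (not p) (not q))

  v : Fin (3 + m) → Vertex (5 + m)
  v y = flip w (avoiding i≢j y)

  v-parity : ∀ {k} y → k ≢ avoiding i≢j y → ∀ {r} → halfLayerParity w k ≡ not r →
    halfLayerParity (v y) k ≡ r
  v-parity {k} y k≢a {r} hw =
    trans (halfLayerParity-flip-other w k≢a) (trans (cong not hw) (not-involutive r))

  edgeOf : Fin (5 + m) → Fin (3 + m) → Edge (5 + m)
  edgeOf k y = proj₁ (edgeAt (v y) k)

  v∈edgeOf : ∀ k y → Endpoint (v y) (edgeOf k y)
  v∈edgeOf k y = proj₁ (proj₂ (edgeAt (v y) k))

  dir-edgeOf : ∀ k y → dir (edgeOf k y) ≡ k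
  dir-edgeOf k y = proj₂ (proj₂ (edgeAt (v y) k))

  removed-once : ∀ {k y y′} {D : Edge (5 + m)} → avoiding i≢j y′ ≢ k → y ≢ y′ →
    edgeOf k y ≡ D → edgeOf k y′ ≡ D → ⊥
  removed-once {k} {y} {y′} a≢k y≢y′ eq eq′ =
    neighbour-edges-distinct w (edgeOf k y) (edgeOf k y′)
      (y≢y′ ∘ avoiding-injective i≢j) (subst (avoiding i≢j y′ ≢_) (sym (dir-edgeOf k y′)) a≢k)
      (v∈edgeOf k y) (v∈edgeOf k y′) (trans eq (sym eq′))

  blocked : ∀ y → ¬ ¬ (edgeOf i y ≡ E ⊎ edgeOf j y ≡ F)
  blocked y unblocked = i≢j (begin
    i                  ≡⟨ sym (dir-edgeOf i y) ⟩
    dir (edgeOf i y)   ≡⟨ matching-dir-unique isMatching Mᵢ Mⱼ (v∈edgeOf i y) (v∈edgeOf j y) ⟩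
    dir (edgeOf j y)   ≡⟨ dir-edgeOf j y ⟩
    j                  ∎)
    where
    open ≡-Reasoning
    Mᵢ : M (edgeOf i y)
    Mᵢ = Hᵢ⊆M _ (inHalfLayer (edgeOf i y) (v∈edgeOf i y) (dir-edgeOf i y)
                   (v-parity y (≢-sym (avoiding≢i i≢j y)) (proj₁ w-parities))) (unblocked ∘ inj₁)
    Mⱼ : M (edgeOf j y)
    Mⱼ = Hⱼ⊆M _ (inHalfLayer (edgeOf j y) (v∈edgeOf j y) (dir-edgeOf j y)
                   (v-parity y (≢-sym (avoiding≢j i≢j y)) (proj₂ w-parities))) (unblocked ∘ inj₂)

lemma3 : ∀ (d : ℕ) → 5 ≤ d → (u : Vertex d) (M : EdgeSet d) → IsMatching M →
  PropertyP d →
  ∀ (i j k : Fin d) → i ≢ j → i ≢ k → j ≢ k →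
  ¬ ( ¬ HamPathThrough M u (flip u i)
    × ¬ HamPathThrough M u (flip u j)
    × ¬ HamPathThrough M u (flip u k) )
lemma3 (suc (suc (suc (suc (suc m))))) (s≤s (s≤s (s≤s (s≤s (s≤s _))))) u M isMatching P
       i j k i≢j i≢k j≢k (¬ham-i , ¬ham-j , ¬ham-k) =
  obstructed ¬ham-i λ oᵢ → obstructed ¬ham-j λ oⱼ → obstructed ¬ham-k λ oₖ →
  pigeonhole₃ (λ x≢y mx my → x≢y (matchedInDirection-unique isMatching mx my))
              (almostHalfLayers-conflict isMatching)
              i≢j i≢k j≢k
              (obstructed-neighbour oᵢ) (obstructed-neighbour oⱼ) (obstructed-neighbour oₖ)
  where
  obstructed : ∀ {x} → ¬ HamPathThrough M u (flip u x) → ¬ ¬ Obstructed M u (flip u x)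
  obstructed {x} ¬ham ¬obs = ¬ham (proj₂ (P M isMatching u (flip u x) parity≢) ¬obs)
    where
    parity≢ : parity u ≢ parity (flip u x)
    parity≢ eq = not-¬ refl (trans eq (parity-flip u x))
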